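{- Every graph $H$ with minimum degree $\delta(H)\ge 4$ is a hideout graph.
   Context: The robber-locating game on a finite connected simple graph $G$: a robber occupies an unknown vertex. In each round the cop probes any vertex $p$ of $G$ (no restriction), and the robber truthfully announces the graph distance from his current vertex to $p$. If the information gathered so far determines the robber's current vertex uniquely, the cop wins. Otherwise the robber moves to an adjacent vertex or stays put, with the no-backtrack condition: he may not move to the vertex $p$ just probed. The robber is omniscient. $G$ is locatable if the cop has a strategy guaranteed to determine the robber's vertex after finitely many probes, and non-locatable otherwise. A graph $H$ is a hideout graph if every (connected) graph containing a (not necessarily induced) subgraph isomorphic to $H$ is non-locatable. -}

module Defs where

open import Data.Nat using (ℕ; zero; suc; _<_; _≥_)
open import Data.Fin using (Fin)
open import Data.Fin.Subset using (∣_∣)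
open import Data.Vec using (tabulate)
open import Data.Bool using (Bool; T; not)
open import Data.Product using (Σ; ∃; _×_; _,_)
open import Data.Sum using (_⊎_)
open import Relation.Binary.PropositionalEquality using (_≡_)
open import Relation.Nullary using (¬_)
open import Level using (Level; 0ℓ) renaming (suc to lsuc)

record Graph : Set where
  field
    size  : ℕ
    adj   : Fin size → Fin size → Bool
    sym   : ∀ u v → adj u v ≡ adj v u
    irrefl : ∀ v → adj v v ≡ Data.Bool.false

open Graph public

Vertex : Graph → Set
Vertex G = Fin (size G)

Adj : (G : Graph) → Vertex G → Vertex G → Set
Adj G u v = T (adj G u v)

degree : (G : Graph) → Vertex G → ℕ
degree G v = ∣ tabulate (adj G v) ∣

MinDegree≥ : Graph → ℕ → Set
MinDegree≥ G k = ∀ (v : Vertex G) → degree G v ≥ k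

data Walk (G : Graph) : ℕ → Vertex G → Vertex G → Set where
  here : ∀ {v} → Walk G zero v v
  step : ∀ {k u w v} → Adj G u w → Walk G k w v → Walk G (suc k) u v

Connected : Graph → Set
Connected G = ∀ (u v : Vertex G) → ∃ λ k → Walk G k u v

Dist : (G : Graph) → Vertex G → Vertex G → ℕ → Set
Dist G u v k = Walk G k u v × (∀ j → j < k → ¬ Walk G j u v)

SubgraphOf : Graph → Graph → Set
SubgraphOf H G =
  Σ (Vertex H → Vertex G) λ f →
    (∀ a b → f a ≡ f b → a ≡ b) × (∀ a b → Adj H a b → Adj G (f a) (f b))

-- The cop's knowledge is the set S of vertices the robber may currently
-- occupy (consistent with all answers so far).  The cop probes p; the
-- robber announces d = dist(r, p), narrowing the set to
--   S_d = { v ∈ S | dist(v,p) = d }.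
-- If S_d is a single vertex the cop wins; otherwise the robber moves to
-- a neighbour or stays, but not onto p, giving the new set
--   { w | w ≠ p, w = v or w ~ v for some v ∈ S_d }.
-- CopWins G S: the cop has a strategy from knowledge S which wins after
-- finitely many probes against every (omniscient) robber; inductive, so
-- every play is finite.

Pred : Graph → Set₁
Pred G = Vertex G → Set

Answer : (G : Graph) → Pred G → Vertex G → ℕ → Pred G
Answer G S p d v = S v × Dist G v p d

Move : (G : Graph) → Pred G → Vertex G → Pred G
Move G S p w = ¬ (w ≡ p) × ∃ λ v → S v × (w ≡ v ⊎ Adj G v w)

NonEmpty : ∀ {G} → Pred G → Set
NonEmpty S = ∃ λ v → S v

AtMostOne : ∀ {G} → Pred G → Set
AtMostOne S = ∀ v w → S v → S w → v ≡ w

data CopWins (G : Graph) (S : Pred G) : Set₁ where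
  probe : (p : Vertex G) →
          (∀ (d : ℕ) → NonEmpty {G} (Answer G S p d) →
             AtMostOne {G} (Answer G S p d) ⊎ CopWins G (Move G (Answer G S p d) p)) →
          CopWins G S

AllVertices : (G : Graph) → Pred G
AllVertices G v = Data.Unit.⊤
  where import Data.Unit

Locatable : Graph → Set₁
Locatable G = CopWins G (AllVertices G)

Hideout : Graph → Set₁
Hideout H = ∀ (G : Graph) → Connected G → SubgraphOf H G → ¬ Locatable G

-- Call a vertex set C of G a hideout core if every vertex of C has, for
-- any excluded vertex p, three distinct neighbours in C other than p (a
-- "claw" avoiding p).  The robber survives as long as the set S of his
-- possible positions contains a vertex of C together with a claw of it in
-- C: the four vertices of the claw lie at distances k-1, k or k+1 from any
-- probe p (k the distance of the centre), so two of them give the same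
-- answer and the cop cannot win; one of them, a, is not p, and a together
-- with a claw of a avoiding p survives the robber's move.
module Submission where

open import Defs
open import Data.Nat using (ℕ; zero; suc; _≤_; _<_; _≥_; z≤n; s≤s)
open import Data.Nat.Properties
  using (≤-reflexive; ≤-trans; ≤-pred; ≤-antisym; n≤1+n; n<1+n; <-cmp; ≮⇒≥; m<1+n⇒m<n∨m≡n)
open import Data.Fin using (Fin; zero; suc; fromℕ<)
import Data.Fin.Properties as Fin
open import Data.Fin.Subset using (Subset; inside; outside; _∈_; _∉_; _─_; _-_; ∣_∣; Nonempty)
open import Data.Fin.Subset.Properties using (p─⊥≡p; p─q⊆p; x∉⁅y⁆⇒x≢y)
open import Data.Vec using (_∷_; tabulate; here; there)
open import Data.Vec.Properties using ([]=⇒lookup; lookup∘tabulate)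
import Data.Vec.Functional as Vector
open import Data.Bool using (T)
open import Data.Bool.Properties using (T-≡)
open import Data.Product using (Σ; ∃; ∃₂; _×_; _,_; proj₁; proj₂)
open import Data.Sum using (_⊎_; inj₁; inj₂; [_,_]′)
open import Data.Empty using (⊥-elim)
open import Data.Unit using (tt)
open import Function using (_∘_)
open import Function.Bundles using (Equivalence)
open import Function.Definitions using (Injective)
open import Relation.Binary using (tri<; tri≈; tri>)
open import Relation.Nullary using (¬_; Dec; yes; no)
open import Relation.Nullary.Decidable using (_×-dec_; T?)
open import Relation.Binary.PropositionalEquality
  using (_≡_; _≢_; refl; trans; cong; subst) renaming (sym to ≡-sym)

module _ {P : ℕ → Set} (P? : ∀ j → Dec (P j)) where

  Least : ℕ → Set
  Least m = P m × (∀ j → j < m → ¬ P j)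

  search : ∀ n → (∀ j → j < n → ¬ P j) ⊎ ∃ Least
  search zero = inj₁ λ j ()
  search (suc n) with search n
  ... | inj₂ found = inj₂ found
  ... | inj₁ none-below with P? n
  ...   | yes pn = inj₂ (n , pn , none-below)
  ...   | no ¬pn = inj₁ λ j j<1+n →
          [ none-below j , (λ { refl → ¬pn }) ]′ (m<1+n⇒m<n∨m≡n j<1+n)

  least : ∀ {n} → P n → ∃ Least
  least {n} pn with search (suc n)
  ... | inj₁ none-below = ⊥-elim (none-below n (n<1+n n) pn)
  ... | inj₂ found = found

data Near : ℕ → ℕ → Set where
  same  : ∀ {k} → Near k k
  above : ∀ {k} → Near k (suc k)
  below : ∀ {d} → Near (suc d) d

near : ∀ {k d} → d ≤ suc k → k ≤ suc d → Near k d
near {k} {d} d≤1+k k≤1+d with <-cmp d k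
... | tri< d<k _ _ = subst (λ k → Near k d) (≤-antisym d<k k≤1+d) below
... | tri≈ _ refl _ = same
... | tri> _ _ k<d = subst (Near k) (≡-sym (≤-antisym d≤1+k k<d)) above

position : ∀ {k d} → Near k d → Fin 3
position same  = zero
position above = suc zero
position below = suc (suc zero)

position-injective : ∀ {k d e} (m : Near k d) (n : Near k e) → position m ≡ position n → d ≡ e
position-injective same  same  _ = refl
position-injective above above _ = refl
position-injective below below _ = refl
position-injective same  above ()
position-injective same  below ()
position-injective above same  ()
position-injective above below ()
position-injective below same  ()
position-injective below above ()

collision : ∀ {n k} → 3 < n → (δ : Fin n → ℕ) → (∀ i → Near k (δ i)) →
            ∃₂ λ i j → i ≢ j × δ i ≡ δ j
collision 3<n δ δ-near with Fin.pigeonhole 3<n (position ∘ δ-near)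
... | i , j , i<j , same-position =
  i , j , Fin.<⇒≢ i<j , position-injective (δ-near i) (δ-near j) same-position

∣p∣≤1+∣p-x∣ : ∀ {n} (p : Subset n) x → ∣ p ∣ ≤ suc ∣ p - x ∣
∣p∣≤1+∣p-x∣ (inside  ∷ p) zero = s≤s (≤-reflexive (cong ∣_∣ (≡-sym (p─⊥≡p p))))
∣p∣≤1+∣p-x∣ (outside ∷ p) zero = ≤-trans (≤-reflexive (cong ∣_∣ (≡-sym (p─⊥≡p p)))) (n≤1+n _)
∣p∣≤1+∣p-x∣ (inside  ∷ p) (suc x) = s≤s (∣p∣≤1+∣p-x∣ p x)
∣p∣≤1+∣p-x∣ (outside ∷ p) (suc x) = ∣p∣≤1+∣p-x∣ p x

x∈p─q⇒x∉q : ∀ {n} (p q : Subset n) {x} → x ∈ p ─ q → x ∉ q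
x∈p─q⇒x∉q (_ ∷ p) (inside  ∷ q) () here
x∈p─q⇒x∉q (_ ∷ p) (_       ∷ q) (there x∈p─q) (there x∈q) = x∈p─q⇒x∉q p q x∈p─q x∈q

x∈p-y⇒x≢y : ∀ {n} (p : Subset n) {x y} → x ∈ p - y → x ≢ y
x∈p-y⇒x≢y p = x∉⁅y⁆⇒x≢y ∘ x∈p─q⇒x∉q p _

nonempty : ∀ {n} (p : Subset n) → 0 < ∣ p ∣ → Nonempty p
nonempty (inside  ∷ p) _ = zero , here
nonempty (outside ∷ p) 0<∣p∣ with nonempty p 0<∣p∣
... | x , x∈p = suc x , there x∈p

distinct-elements : ∀ {n} k (p : Subset n) → k ≤ ∣ p ∣ →
                    Σ (Fin k → Fin n) λ g → Injective _≡_ _≡_ g × (∀ i → g i ∈ p)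
distinct-elements zero p _ = (λ ()) , (λ { {()} }) , (λ ())
distinct-elements (suc k) p k<∣p∣ with nonempty p (≤-trans (s≤s z≤n) k<∣p∣)
... | x , x∈p with distinct-elements k (p - x) (≤-pred (≤-trans k<∣p∣ (∣p∣≤1+∣p-x∣ p x)))
...   | g , g-injective , g∈p-x = x Vector.∷ g , injective , member
  where
  fresh : ∀ i → g i ≢ x
  fresh i = x∈p-y⇒x≢y p (g∈p-x i)

  injective : Injective _≡_ _≡_ (x Vector.∷ g)
  injective {zero}  {zero}  _  = refl
  injective {zero}  {suc j} eq = ⊥-elim (fresh j (≡-sym eq))
  injective {suc i} {zero}  eq = ⊥-elim (fresh i eq)
  injective {suc i} {suc j} eq = cong suc (g-injective eq)

  member : ∀ i → (x Vector.∷ g) i ∈ p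
  member zero    = x∈p
  member (suc i) = p─q⊆p p _ (g∈p-x i)

module _ (G : Graph) where

  adj-sym : ∀ {u v} → Adj G u v → Adj G v u
  adj-sym {u} {v} = subst T (Graph.sym G u v)

  adj-irrefl : ∀ {u v} → Adj G u v → u ≢ v
  adj-irrefl {u} u~u refl = subst T (irrefl G u) u~u

  walk? : ∀ j u v → Dec (Walk G j u v)
  walk? zero u v with u Fin.≟ v
  ... | yes refl = yes here
  ... | no u≢v = no λ { here → u≢v refl }
  walk? (suc j) u v with Fin.any? (λ w → T? (adj G u w) ×-dec walk? j w v)
  ... | yes (w , u~w , walk) = yes (step u~w walk)
  ... | no no-step = no λ { (step u~w walk) → no-step (_ , u~w , walk) }

  -- Kept opaque, since only this specification is used
  -- and unfolding the search makes type checking very expensive.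
  opaque
    distance : Connected G → ∀ x y → ∃ (Dist G x y)
    distance connected x y = least (λ j → walk? j x y) (proj₂ (connected x y))

  dist-unique : ∀ {x y d e} → Dist G x y d → Dist G x y e → d ≡ e
  dist-unique {d = d} {e} (walk-d , shortest-d) (walk-e , shortest-e) with <-cmp d e
  ... | tri< d<e _ _ = ⊥-elim (shortest-e d d<e walk-d)
  ... | tri≈ _ d≡e _ = d≡e
  ... | tri> _ _ e<d = ⊥-elim (shortest-d e e<d walk-e)

  dist-step : ∀ {x y p k k′} → Adj G x y → Dist G y p k → Dist G x p k′ → k′ ≤ suc k
  dist-step {k = k} x~y (walk-y , _) (_ , shortest-x) =
    ≮⇒≥ λ 1+k<k′ → shortest-x (suc k) 1+k<k′ (step x~y walk-y)

  adjacent-near : ∀ {x y p k d} → Adj G x y → Dist G x p k → Dist G y p d → Near k d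
  adjacent-near x~y Dx Dy = near (dist-step (adj-sym x~y) Dx Dy) (dist-step x~y Dy Dx)

  equidistant-≢ : ∀ {a b p d} → a ≢ b → Dist G a p d → Dist G b p d → a ≢ p
  equidistant-≢ a≢b Da Db refl with dist-unique Da (here , λ j ())
  ... | refl with Db
  ...   | here , _ = a≢b refl

record Claw (G : Graph) (centre : Vertex G) (P : Pred G) : Set where
  field
    leg           : Fin 3 → Vertex G
    leg-injective : Injective _≡_ _≡_ leg
    leg-adj       : ∀ i → Adj G centre (leg i)
    leg-P         : ∀ i → P (leg i)

  point : Fin 4 → Vertex G
  point = centre Vector.∷ leg

  point-injective : Injective _≡_ _≡_ point
  point-injective {zero}  {zero}  _  = refl
  point-injective {zero}  {suc j} eq = ⊥-elim (adj-irrefl G (leg-adj j) eq)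
  point-injective {suc i} {zero}  eq = ⊥-elim (adj-irrefl G (leg-adj i) (≡-sym eq))
  point-injective {suc i} {suc j} eq = cong suc (leg-injective eq)

  point-P : P centre → ∀ i → P (point i)
  point-P P-centre zero    = P-centre
  point-P P-centre (suc i) = leg-P i

claw-map : ∀ {G v} {P Q : Pred G} → (∀ {w} → Adj G v w → P w → Q w) → Claw G v P → Claw G v Q
claw-map P⇒Q c = record
  { leg           = leg
  ; leg-injective = leg-injective
  ; leg-adj       = leg-adj
  ; leg-P         = λ i → P⇒Q (leg-adj i) (leg-P i)
  }
  where open Claw c

claw-transport : ∀ {H G a} {P : Pred H} {Q : Pred G} (f : Vertex H → Vertex G) →
                 Injective _≡_ _≡_ f → (∀ {u v} → Adj H u v → Adj G (f u) (f v)) →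
                 (∀ {n} → P n → Q (f n)) → Claw H a P → Claw G (f a) Q
claw-transport f f-injective f-adj P⇒Q c = record
  { leg           = f ∘ leg
  ; leg-injective = leg-injective ∘ f-injective
  ; leg-adj       = f-adj ∘ leg-adj
  ; leg-P         = P⇒Q ∘ leg-P
  }
  where open Claw c

HideoutCore : (G : Graph) → Pred G → Set
HideoutCore G C = ∀ {v} → C v → ∀ p → Claw G v (λ w → C w × w ≢ p)

module Escape (G : Graph) (connected : Connected G) (C : Pred G) (core : HideoutCore G C) where

  _∩_ : Pred G → Pred G → Pred G
  (S ∩ T) v = S v × T v

  -- Pigeonhole: for any probe p, two distinct points of a claw are
  -- equidistant from p, as all four lie within one of the centre's distance.
  equidistant-points : ∀ {v P} (c : Claw G v P) p →
    ∃₂ λ i j → i ≢ j × ∃ λ d → Dist G (Claw.point c i) p d × Dist G (Claw.point c j) p d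
  equidistant-points c p = coincide (collision (n<1+n 3) (proj₁ ∘ D) near-centre)
    where
    open Claw c
    D : ∀ i → ∃ (Dist G (point i) p)
    D i = distance G connected (point i) p
    near-centre : ∀ i → Near (proj₁ (D zero)) (proj₁ (D i))
    near-centre zero    = same
    near-centre (suc i) = adjacent-near G (leg-adj i) (proj₂ (D zero)) (proj₂ (D (suc i)))
    coincide : (∃₂ λ i j → i ≢ j × proj₁ (D i) ≡ proj₁ (D j)) →
               ∃₂ λ i j → i ≢ j × ∃ λ d → Dist G (point i) p d × Dist G (point j) p d
    coincide (i , j , i≢j , same-distance) =
      i , j , i≢j , proj₁ (D i) , proj₂ (D i) ,
      subst (Dist G (point j) p) (≡-sym same-distance) (proj₂ (D j))

  Trapped : Pred G → Set
  Trapped S = Σ (Vertex G) λ v → (C ∩ S) v × Claw G v (C ∩ S)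

  Tie : Pred G → Vertex G → Set
  Tie S p = Σ ℕ λ d → Σ (Vertex G) λ a → Σ (Vertex G) λ b →
            a ≢ b × C a × Answer G S p d a × Answer G S p d b

  tie : ∀ {S} → Trapped S → ∀ p → Tie S p
  tie {S} (v , C∩S-v , c) p with equidistant-points c p
  ... | i , j , i≢j , d , Di , Dj =
    d , point i , point j , i≢j ∘ point-injective ,
    proj₁ (member i) , (proj₂ (member i) , Di) , (proj₂ (member j) , Dj)
    where
    open Claw c
    member : ∀ i → (C ∩ S) (point i)
    member = point-P C∩S-v

  -- After a tie at a, the robber can stay at a or walk to a claw of a avoiding p.
  retrap : ∀ {S p d a} → a ≢ p → C a → Answer G S p d a →
           Trapped (Move G (Answer G S p d) p)
  retrap {p = p} {a = a} a≢p Ca ans-a =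
    a , (Ca , a≢p , a , ans-a , inj₁ refl) ,
    claw-map (λ a~w (Cw , w≢p) → Cw , w≢p , a , ans-a , inj₂ a~w) (core Ca p)

  escape : ∀ {S} → Trapped S → ¬ CopWins G S
  escape trapped (probe p continue) with tie trapped p
  ... | d , a , b , a≢b , Ca , ans-a , ans-b with continue d (a , ans-a)
  ...   | inj₁ located = a≢b (located a b ans-a ans-b)
  ...   | inj₂ wins = escape (retrap (equidistant-≢ G a≢b (proj₂ ans-a) (proj₂ ans-b)) Ca ans-a) wins

  non-locatable : NonEmpty {G} C → ¬ Locatable G
  non-locatable (v , Cv) = escape {AllVertices G} (v , (Cv , tt) , claw-map in-C (core Cv v))
    where
    in-C : ∀ {w} → Adj G v w → C w × w ≢ v → (C ∩ AllVertices G) w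
    in-C _ (Cw , _) = Cw , tt

-- The image of a graph of minimum degree ≥ 4 is a hideout core; this
-- gives the theorem, since H has a vertex whose image is a starting point.

neighbours : (H : Graph) → Vertex H → Subset (size H)
neighbours H a = tabulate (adj H a)

∈-neighbours : ∀ H {a i} → i ∈ neighbours H a → Adj H a i
∈-neighbours H {a} {i} i∈N =
  Equivalence.from T-≡ (trans (≡-sym (lookup∘tabulate (adj H a) i)) ([]=⇒lookup i∈N))

-- A vertex of degree at least 4 has a claw avoiding any given vertex c:
-- the neighbourhood without c still has three elements.
claw-avoiding : ∀ H {a} → 4 ≤ degree H a → ∀ c → Claw H a (_≢ c)
claw-avoiding H {a} deg≥4 c =
  legs (distinct-elements 3 (N - c) (≤-pred (≤-trans deg≥4 (∣p∣≤1+∣p-x∣ N c))))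
  where
  N : Subset (size H)
  N = neighbours H a
  legs : Σ (Fin 3 → Vertex H) (λ g → Injective _≡_ _≡_ g × (∀ i → g i ∈ N - c)) → Claw H a (_≢ c)
  legs (g , g-injective , g∈N-c) = record
    { leg           = g
    ; leg-injective = g-injective
    ; leg-adj       = λ i → ∈-neighbours H (p─q⊆p N _ (g∈N-c i))
    ; leg-P         = λ i → x∈p-y⇒x≢y N (g∈N-c i)
    }

Image : ∀ {A B : Set} → (A → B) → B → Set
Image f v = ∃ λ a → f a ≡ v

preimage-candidate : ∀ {m n} (f : Fin m → Fin n) → Injective _≡_ _≡_ f →
                     Fin m → ∀ p → ∃ λ c → ∀ x → f x ≡ p → x ≡ c
preimage-candidate f f-injective default p with Fin.any? {P = λ c → f c ≡ p} (λ c → f c Fin.≟ p)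
... | yes (c , fc≡p) = c , λ x fx≡p → f-injective (trans fx≡p (≡-sym fc≡p))
... | no no-preimage = default , λ x fx≡p → ⊥-elim (no-preimage (x , fx≡p))

-- Claws of H avoiding the preimage of p map to claws of G avoiding p.
image-core : ∀ H G → MinDegree≥ H 4 → (f : Vertex H → Vertex G) → Injective _≡_ _≡_ f →
             (∀ {u v} → Adj H u v → Adj G (f u) (f v)) → HideoutCore G (Image f)
image-core H G δ f f-injective f-adj (a , refl) p with preimage-candidate f f-injective a p
... | c , only-c =
  claw-transport f f-injective f-adj
    (λ {n} n≢c → (n , refl) , n≢c ∘ only-c n)
    (claw-avoiding H (δ a) c)

theorem4p3 : ∀ (H : Graph) → size H ≥ 1 → MinDegree≥ H 4 → Hideout H
theorem4p3 H size≥1 δ G connected (f , f-injective , f-adj) =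
  Escape.non-locatable G connected (Image f)
    (image-core H G δ f (f-injective _ _) (f-adj _ _))
    (f a₀ , a₀ , refl)
  where
  a₀ : Vertex H
  a₀ = fromℕ< size≥1
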